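{- For all integers $0\le m\le n$, $$\sum_{k=0}^{m}(-1)^{m-k}x^{\binom k2}y^{\binom{n-k}2}{n\brack k}_{x,y}\prod_{i=0}^{k-1}\bigl\{1-ax^i[n-i]_{x,y}\bigr\}\prod_{i=k}^{m-1}\bigl\{ -ax^i[n-i]_{x,y}\bigr\} = x^{\binom m2}y^{\binom{n-m}2}{n\brack m}_{x,y}\prod_{i=1}^{m}\bigl\{1-ax^i[n-i]_{x,y}\bigr\}.$$
   Context: $x,y,a$ are indeterminates; $[n]_{x,y}=\frac{x^n-y^n}{x-y}$, $[n]_{x,y}!=\prod_{m=1}^n[m]_{x,y}$, ${n\brack k}_{x,y}=\frac{[n]_{x,y}!}{[k]_{x,y}![n-k]_{x,y}!}$ for $0\le k\le n$; empty products equal $1$. -}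

module Defs where

open import Algebra.Bundles using (CommutativeRing)
open import Data.Nat using (ℕ; zero; suc; _+_; _∸_)
open import Data.Nat.Combinatorics using (_C_)

-- Polynomial identities in the indeterminates x, y, a (over ℤ) are stated
-- equivalently as identities valid for all elements x, y, a of every
-- commutative ring (ℤ[x,y,a] being the universal case).
module XY {c ℓ} (R : CommutativeRing c ℓ) where
  open CommutativeRing R using (Carrier; 0#; 1#; -_; _-_) renaming (_+_ to _+R_; _*_ to _*R_)
  private
    infixl 7 _*_
    infixl 6 _⊕_
    _*_ = _*R_
    _⊕_ = _+R_

  pow : Carrier → ℕ → Carrier
  pow x zero = 1#
  pow x (suc n) = x * pow x n

  sumTo : (ℕ → Carrier) → ℕ → Carrier
  sumTo f zero = f zero
  sumTo f (suc m) = sumTo f m ⊕ f (suc m)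

  prodBelow : (ℕ → Carrier) → ℕ → Carrier
  prodBelow f zero = 1#
  prodBelow f (suc n) = prodBelow f n * f n

  prodRange : (ℕ → Carrier) → ℕ → ℕ → Carrier
  prodRange f lo hi = prodBelow (λ j → f (lo + j)) (hi ∸ lo)

  -- [n]_{x,y} = (x^n - y^n)/(x - y) = sum_{j=0}^{n-1} x^j y^{n-1-j}
  bracket : Carrier → Carrier → ℕ → Carrier
  bracket x y zero = 0#
  bracket x y (suc n) = pow x n ⊕ y * bracket x y n

  bfact : Carrier → Carrier → ℕ → Carrier
  bfact x y n = prodRange (bracket x y) 1 (suc n)

  -- Gaussian (x,y)-binomial [n choose k]_{x,y} (as a polynomial), via the
  -- (x,y)-Pascal rule [n+1, k+1] = x^{k+1} [n, k+1] + y^{n-k} [n, k],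
  -- [n,0] = 1, [0,k+1] = 0.
  gbinom : Carrier → Carrier → ℕ → ℕ → Carrier
  gbinom x y n zero = 1#
  gbinom x y zero (suc k) = 0#
  gbinom x y (suc n) (suc k) =
    pow x (suc k) * gbinom x y n (suc k) ⊕ pow y (n ∸ k) * gbinom x y n k

  oneMinus : Carrier → Carrier → Carrier → ℕ → ℕ → Carrier
  oneMinus x y a n i = 1# - a * pow x i * bracket x y (n ∸ i)

  minusA : Carrier → Carrier → Carrier → ℕ → ℕ → Carrier
  minusA x y a n i = - (a * pow x i * bracket x y (n ∸ i))

  lhsTerm : Carrier → Carrier → Carrier → ℕ → ℕ → ℕ → Carrier
  lhsTerm x y a m n k =
    pow (- 1#) (m ∸ k) * pow x (k C 2) * pow y ((n ∸ k) C 2) * gbinom x y n k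
      * prodRange (oneMinus x y a n) 0 k
      * prodRange (minusA x y a n) k m

  lhs : Carrier → Carrier → Carrier → ℕ → ℕ → Carrier
  lhs x y a m n = sumTo (lhsTerm x y a m n) m

  rhs : Carrier → Carrier → Carrier → ℕ → ℕ → Carrier
  rhs x y a m n =
    pow x (m C 2) * pow y ((n ∸ m) C 2) * gbinom x y n m
      * prodRange (oneMinus x y a n) 1 (suc m)

{-# OPTIONS --safe #-}

-- With B i = a x^i [n-i] and c k = x^(k C 2) y^((n-k) C 2) [n k], the signs (-1)^(m-k) cancel
-- against the factors -B i, so the left side is S m = Σ_{k≤m} c k ∏_{i<k}(1 - B i) ∏_{k≤i<m} B i,
-- which satisfies S (m+1) = S m · B m + c (m+1) ∏_{i≤m}(1 - B i). The right side satisfies the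
-- same recurrence because c m · B m + c (m+1) · B (m+1) = c (m+1) · B 0, which is the absorption
-- identity [n-m] [n m] = [m+1] [n m+1] combined with [n] = x^(m+1) [n-m-1] + y^(n-m-1) [m+1].
module Submission where

open import Defs
open import Algebra.Bundles using (CommutativeRing)
open import Data.Nat as ℕ using (ℕ; zero; suc; _∸_; _≤_; _<_; z≤n; s≤s)
open import Data.Nat.Properties
  using (≤-refl; <⇒≤; m≤n⇒m≤1+n; m<n⇒m<1+n; <-≤-connex; +-∸-assoc; m+[n∸m]≡n; m∸n+n≡m; n∸n≡0; m≤n⇒m∸n≡0)
open import Data.Nat.Combinatorics using (_C_; nCk+nC[k+1]≡[n+1]C[k+1]; nC1≡n)
open import Data.Sum using (inj₁; inj₂)
import Relation.Binary.PropositionalEquality as ≡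

suc-C2 : ∀ m → suc m C 2 ≡.≡ m ℕ.+ m C 2
suc-C2 m = ≡.trans (≡.sym (nCk+nC[k+1]≡[n+1]C[k+1] m 1)) (≡.cong (ℕ._+ m C 2) (nC1≡n m))

module _ {c ℓ} (R : CommutativeRing c ℓ) where
  open CommutativeRing R
  open XY R
  open import Algebra.Properties.Ring ring using (-1*x≈-x; -‿involutive; +-cancelʳ)
  open import Algebra.Solver.Ring.NaturalCoefficients.Default commutativeSemiring
    using (solve; _:=_; _:+_; _:*_; con)
  open import Relation.Binary.Reasoning.Setoid setoid

  pow-+ : ∀ z p q → pow z (p ℕ.+ q) ≈ pow z p * pow z q
  pow-+ z zero    q = sym (*-identityˡ _)
  pow-+ z (suc p) q = trans (*-congˡ (pow-+ z p q)) (sym (*-assoc _ _ _))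

  pow-C2-suc : ∀ z m → pow z (suc m C 2) ≈ pow z m * pow z (m C 2)
  pow-C2-suc z m = trans (reflexive (≡.cong (pow z) (suc-C2 m))) (pow-+ z m (m C 2))

  *-complement : ∀ v t → v * (1# - t) + v * t ≈ v
  *-complement v t = begin
    v * (1# - t) + v * t ≈⟨ distribˡ v (1# - t) t ⟨
    v * (1# - t + t)     ≈⟨ *-congˡ (+-assoc 1# (- t) t) ⟩
    v * (1# + (- t + t)) ≈⟨ *-congˡ (+-congˡ (-‿inverseˡ t)) ⟩
    v * (1# + 0#)        ≈⟨ *-congˡ (+-identityʳ 1#) ⟩
    v * 1#               ≈⟨ *-identityʳ v ⟩
    v                    ∎

  complement-exchange : ∀ {u v t₀ t₁} → u + v * t₁ ≈ v * t₀ →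
                        u + v * (1# - t₀) ≈ v * (1# - t₁)
  complement-exchange {u} {v} {t₀} {t₁} eq = +-cancelʳ (v * t₁) _ _ (begin
    u + v * (1# - t₀) + v * t₁   ≈⟨ solve 3 (λ u s w → u :+ s :+ w := s :+ (u :+ w)) refl u (v * (1# - t₀)) (v * t₁) ⟩
    v * (1# - t₀) + (u + v * t₁) ≈⟨ +-congˡ eq ⟩
    v * (1# - t₀) + v * t₀       ≈⟨ *-complement v t₀ ⟩
    v                            ≈⟨ *-complement v t₁ ⟨
    v * (1# - t₁) + v * t₁       ∎)

  prodBelow-sucˡ : ∀ f m → prodBelow f (suc m) ≈ f 0 * prodBelow (λ i → f (suc i)) m
  prodBelow-sucˡ f zero    = *-comm _ _
  prodBelow-sucˡ f (suc m) = trans (*-congʳ (prodBelow-sucˡ f m)) (*-assoc _ _ _)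

  sign-prodBelow-neg : ∀ f m → pow (- 1#) m * prodBelow (λ i → - f i) m ≈ prodBelow f m
  sign-prodBelow-neg f zero    = *-identityˡ 1#
  sign-prodBelow-neg f (suc m) = begin
    - 1# * s * (p * - f m)   ≈⟨ solve 4 (λ o s p g → o :* s :* (p :* g) := s :* p :* (o :* g)) refl (- 1#) s p (- f m) ⟩
    s * p * (- 1# * - f m)   ≈⟨ *-cong (sign-prodBelow-neg f m) (trans (-1*x≈-x (- f m)) (-‿involutive (f m))) ⟩
    prodBelow f m * f m      ∎
    where
    s = pow (- 1#) m
    p = prodBelow (λ i → - f i) m

  prodRange-empty : ∀ f n → prodRange f n n ≈ 1#
  prodRange-empty f n = reflexive (≡.cong (prodBelow _) (n∸n≡0 n))

  prodRange-extendʳ : ∀ f {lo hi} → lo ≤ hi → prodRange f lo (suc hi) ≈ prodRange f lo hi * f hi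
  prodRange-extendʳ f {lo} {hi} lo≤hi = begin
    prodBelow g (suc hi ∸ lo)                    ≡⟨ ≡.cong (prodBelow g) (+-∸-assoc 1 lo≤hi) ⟩
    prodBelow g (hi ∸ lo) * f (lo ℕ.+ (hi ∸ lo)) ≡⟨ ≡.cong (λ i → prodBelow g (hi ∸ lo) * f i) (m+[n∸m]≡n lo≤hi) ⟩
    prodBelow g (hi ∸ lo) * f hi                 ∎
    where
    g = λ j → f (lo ℕ.+ j)

  sumTo-cong : ∀ {f g} m → (∀ k → f k ≈ g k) → sumTo f m ≈ sumTo g m
  sumTo-cong zero    f≈g = f≈g 0
  sumTo-cong (suc m) f≈g = +-cong (sumTo-cong m f≈g) (f≈g (suc m))

  sumTo-factorʳ : ∀ {f g} c m → (∀ k → k ≤ m → f k ≈ g k * c) → sumTo f m ≈ sumTo g m * c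
  sumTo-factorʳ c zero    f≈gc = f≈gc 0 z≤n
  sumTo-factorʳ {f} {g} c (suc m) f≈gc = begin
    sumTo f m + f (suc m)          ≈⟨ +-cong (sumTo-factorʳ c m (λ k k≤m → f≈gc k (m≤n⇒m≤1+n k≤m))) (f≈gc (suc m) ≤-refl) ⟩
    sumTo g m * c + g (suc m) * c  ≈⟨ distribʳ c _ _ ⟨
    (sumTo g m + g (suc m)) * c    ∎

  sumTo-prodRange-suc : ∀ (w f : ℕ → Carrier) m →
    sumTo (λ k → w k * prodRange f k (suc m)) (suc m) ≈ sumTo (λ k → w k * prodRange f k m) m * f m + w (suc m)
  sumTo-prodRange-suc w f m = +-cong
    (sumTo-factorʳ (f m) m (λ k k≤m → trans (*-congˡ (prodRange-extendʳ f k≤m)) (sym (*-assoc _ _ _))))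
    (trans (*-congˡ (prodRange-empty f (suc m))) (*-identityʳ _))

  module _ (x y : Carrier) where

    bracket-+ : ∀ p q → bracket x y (p ℕ.+ q) ≈ pow x q * bracket x y p + pow y p * bracket x y q
    bracket-+ zero    q = solve 2 (λ u b → b := u :* con 0 :+ con 1 :* b) refl (pow x q) (bracket x y q)
    bracket-+ (suc p) q = begin
      pow x (p ℕ.+ q) + y * bracket x y (p ℕ.+ q)
        ≈⟨ +-cong (pow-+ x p q) (*-congˡ (bracket-+ p q)) ⟩
      pow x p * pow x q + y * (pow x q * bracket x y p + pow y p * bracket x y q)
        ≈⟨ solve 6 (λ xp xq y bp yp bq → xp :* xq :+ y :* (xq :* bp :+ yp :* bq) := xq :* (xp :+ y :* bp) :+ y :* yp :* bq)
             refl (pow x p) (pow x q) y (bracket x y p) (pow y p) (bracket x y q) ⟩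
      pow x q * (pow x p + y * bracket x y p) + y * pow y p * bracket x y q ∎

    bracket-split : ∀ {k n} → k ≤ n → bracket x y n ≈ pow x k * bracket x y (n ∸ k) + pow y (n ∸ k) * bracket x y k
    bracket-split {k} {n} k≤n = trans (reflexive (≡.cong (bracket x y) (≡.sym (m∸n+n≡m k≤n)))) (bracket-+ (n ∸ k) k)

    gbinom-zero : ∀ {n k} → n < k → gbinom x y n k ≈ 0#
    gbinom-zero {zero}  {suc k} _         = refl
    gbinom-zero {suc n} {suc k} (s≤s n<k) = begin
      pow x (suc k) * gbinom x y n (suc k) + pow y (n ∸ k) * gbinom x y n k
        ≈⟨ +-cong (*-congˡ (gbinom-zero (m<n⇒m<1+n n<k))) (*-congˡ (gbinom-zero n<k)) ⟩
      pow x (suc k) * 0# + pow y (n ∸ k) * 0#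
        ≈⟨ +-cong (zeroʳ _) (zeroʳ _) ⟩
      0# + 0#
        ≈⟨ +-identityʳ 0# ⟩
      0# ∎

    bracket-1 : bracket x y 1 ≈ 1#
    bracket-1 = solve 1 (λ y → con 1 :+ y :* con 0 := con 1) refl y

    gbinom-1 : ∀ n → gbinom x y n 1 ≈ bracket x y n
    gbinom-1 zero    = refl
    gbinom-1 (suc n) = begin
      pow x 1 * gbinom x y n 1 + pow y n * 1#          ≈⟨ +-cong (*-congˡ (gbinom-1 n)) (*-congˡ (sym bracket-1)) ⟩
      pow x 1 * bracket x y n + pow y n * bracket x y 1 ≈⟨ bracket-split {n = suc n} (s≤s z≤n) ⟨
      bracket x y (suc n)                               ∎

    gbinom-absorb : ∀ n k → bracket x y (n ∸ k) * gbinom x y n k ≈ bracket x y (suc k) * gbinom x y n (suc k)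
    gbinom-absorb zero    zero    = trans (zeroˡ _) (sym (zeroʳ _))
    gbinom-absorb zero    (suc k) = trans (zeroˡ _) (sym (zeroʳ _))
    gbinom-absorb (suc n) zero    = begin
      bracket x y (suc n) * 1#             ≈⟨ *-comm _ 1# ⟩
      1# * bracket x y (suc n)             ≈⟨ *-cong bracket-1 (gbinom-1 (suc n)) ⟨
      bracket x y 1 * gbinom x y (suc n) 1 ∎
    gbinom-absorb (suc n) (suc k) with <-≤-connex k n
    ... | inj₂ n≤k = begin
      bracket x y (n ∸ k) * gbinom x y (suc n) (suc k)           ≡⟨ ≡.cong (λ i → bracket x y i * gbinom x y (suc n) (suc k)) (m≤n⇒m∸n≡0 n≤k) ⟩
      0# * gbinom x y (suc n) (suc k)                            ≈⟨ zeroˡ _ ⟩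
      0#                                                         ≈⟨ zeroʳ _ ⟨
      bracket x y (suc (suc k)) * 0#                             ≈⟨ *-congˡ (gbinom-zero (s≤s (s≤s n≤k))) ⟨
      bracket x y (suc (suc k)) * gbinom x y (suc n) (suc (suc k)) ∎
    ... | inj₁ k<n = trans expand-at-k (sym expand-at-suc-k)
      where
      xk = pow x (suc k)
      xk₁ = pow x (suc (suc k))
      y₀ = pow y (n ∸ k)
      y₁ = pow y (n ∸ suc k)
      b₀ = bracket x y (n ∸ k)
      b₁ = bracket x y (n ∸ suc k)
      c₀ = bracket x y (suc k)
      c₁ = bracket x y (suc (suc k))
      g₀ = gbinom x y n k
      g₁ = gbinom x y n (suc k)
      g₂ = gbinom x y n (suc (suc k))

      expand-at-k : b₀ * (xk * g₁ + y₀ * g₀) ≈ bracket x y (suc n) * g₁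
      expand-at-k = begin
        b₀ * (xk * g₁ + y₀ * g₀)
          ≈⟨ solve 5 (λ b xk g₁ y₀ g₀ → b :* (xk :* g₁ :+ y₀ :* g₀) := xk :* b :* g₁ :+ y₀ :* (b :* g₀))
               refl b₀ xk g₁ y₀ g₀ ⟩
        xk * b₀ * g₁ + y₀ * (b₀ * g₀) ≈⟨ +-congˡ (*-congˡ (gbinom-absorb n k)) ⟩
        xk * b₀ * g₁ + y₀ * (c₀ * g₁)
          ≈⟨ solve 5 (λ xk b g₁ y₀ c → xk :* b :* g₁ :+ y₀ :* (c :* g₁) := (xk :* b :+ y₀ :* c) :* g₁)
               refl xk b₀ g₁ y₀ c₀ ⟩
        (xk * b₀ + y₀ * c₀) * g₁      ≈⟨ *-congʳ (bracket-split (s≤s (<⇒≤ k<n))) ⟨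
        bracket x y (suc n) * g₁      ∎

      expand-at-suc-k : c₁ * (xk₁ * g₂ + y₁ * g₁) ≈ bracket x y (suc n) * g₁
      expand-at-suc-k = begin
        c₁ * (xk₁ * g₂ + y₁ * g₁)
          ≈⟨ solve 5 (λ c xk₁ g₂ y₁ g₁ → c :* (xk₁ :* g₂ :+ y₁ :* g₁) := xk₁ :* (c :* g₂) :+ y₁ :* c :* g₁)
               refl c₁ xk₁ g₂ y₁ g₁ ⟩
        xk₁ * (c₁ * g₂) + y₁ * c₁ * g₁ ≈⟨ +-congʳ (*-congˡ (gbinom-absorb n (suc k))) ⟨
        xk₁ * (b₁ * g₁) + y₁ * c₁ * g₁
          ≈⟨ solve 5 (λ xk₁ b g₁ y₁ c → xk₁ :* (b :* g₁) :+ y₁ :* c :* g₁ := (xk₁ :* b :+ y₁ :* c) :* g₁)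
               refl xk₁ b₁ g₁ y₁ c₁ ⟩
        (xk₁ * b₁ + y₁ * c₁) * g₁      ≈⟨ *-congʳ (bracket-split (s≤s k<n)) ⟨
        bracket x y (suc n) * g₁       ∎

  -- oneMinus x y a n i and minusA x y a n i are definitionally 1# - B i and - B i.
  module _ (x y a : Carrier) (n : ℕ) where

    B : ℕ → Carrier
    B i = a * pow x i * bracket x y (n ∸ i)

    coeff : ℕ → Carrier
    coeff k = pow x (k C 2) * pow y ((n ∸ k) C 2) * gbinom x y n k

    weight : ℕ → Carrier
    weight k = coeff k * prodRange (oneMinus x y a n) 0 k

    lhsTerm≈weight*prodRange : ∀ m k → lhsTerm x y a m n k ≈ weight k * prodRange B k m
    lhsTerm≈weight*prodRange m k = begin
      s * X * Y * G * P * N  ≈⟨ solve 6 (λ s X Y G P N → s :* X :* Y :* G :* P :* N := X :* Y :* G :* P :* (s :* N)) refl s X Y G P N ⟩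
      X * Y * G * P * (s * N) ≈⟨ *-congˡ (sign-prodBelow-neg (λ j → B (k ℕ.+ j)) (m ∸ k)) ⟩
      weight k * prodRange B k m ∎
      where
      s = pow (- 1#) (m ∸ k)
      X = pow x (k C 2)
      Y = pow y ((n ∸ k) C 2)
      G = gbinom x y n k
      P = prodRange (oneMinus x y a n) 0 k
      N = prodRange (minusA x y a n) k m

    coeff-B-step : ∀ {m} → m < n → coeff m * B m + coeff (suc m) * B (suc m) ≈ coeff (suc m) * B 0
    coeff-B-step {m} m<n = begin
      X * Y * G * (a * xm * bracket x y (n ∸ m)) + X₁ * Y₁ * G₁ * (a * xs * br)
        ≈⟨ +-congʳ (*-congʳ (*-congʳ (*-congˡ (trans (reflexive (≡.cong (λ i → pow y (i C 2)) (+-∸-assoc 1 m<n))) (pow-C2-suc y r))))) ⟩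
      X * (yr * Y₁) * G * (a * xm * bracket x y (n ∸ m)) + X₁ * Y₁ * G₁ * (a * xs * br)
        ≈⟨ +-congʳ (solve 7 (λ X yr Y₁ G a xm b → X :* (yr :* Y₁) :* G :* (a :* xm :* b) := xm :* X :* Y₁ :* (a :* yr) :* (b :* G))
             refl X yr Y₁ G a xm (bracket x y (n ∸ m))) ⟩
      xm * X * Y₁ * (a * yr) * (bracket x y (n ∸ m) * G) + X₁ * Y₁ * G₁ * (a * xs * br)
        ≈⟨ +-congʳ (*-cong (*-congʳ (*-congʳ (pow-C2-suc x m))) (sym (gbinom-absorb x y n m))) ⟨
      X₁ * Y₁ * (a * yr) * (bs * G₁) + X₁ * Y₁ * G₁ * (a * xs * br)
        ≈⟨ solve 8 (λ X₁ Y₁ a yr bs G₁ xs br → X₁ :* Y₁ :* (a :* yr) :* (bs :* G₁) :+ X₁ :* Y₁ :* G₁ :* (a :* xs :* br)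
                                            := X₁ :* Y₁ :* G₁ :* (a :* con 1 :* (xs :* br :+ yr :* bs)))
             refl X₁ Y₁ a yr bs G₁ xs br ⟩
      X₁ * Y₁ * G₁ * (a * 1# * (xs * br + yr * bs))
        ≈⟨ *-congˡ (*-congˡ (bracket-split x y m<n)) ⟨
      coeff (suc m) * B 0 ∎
      where
      r = n ∸ suc m
      X = pow x (m C 2)
      Y = pow y ((n ∸ m) C 2)
      G = gbinom x y n m
      X₁ = pow x (suc m C 2)
      Y₁ = pow y (r C 2)
      G₁ = gbinom x y n (suc m)
      xm = pow x m
      xs = pow x (suc m)
      yr = pow y r
      br = bracket x y r
      bs = bracket x y (suc m)

    rhs-step : ∀ {m} → m < n → rhs x y a m n * B m + weight (suc m) ≈ rhs x y a (suc m) n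
    rhs-step {m} m<n = begin
      coeff m * P * B m + coeff (suc m) * prodBelow (oneMinus x y a n) (suc m)
        ≈⟨ +-congˡ (*-congˡ (prodBelow-sucˡ (oneMinus x y a n) m)) ⟩
      coeff m * P * B m + coeff (suc m) * ((1# - B 0) * P)
        ≈⟨ solve 5 (λ c P b c₁ o → c :* P :* b :+ c₁ :* (o :* P) := P :* (c :* b :+ c₁ :* o))
             refl (coeff m) P (B m) (coeff (suc m)) (1# - B 0) ⟩
      P * (coeff m * B m + coeff (suc m) * (1# - B 0))
        ≈⟨ *-congˡ (complement-exchange (coeff-B-step m<n)) ⟩
      P * (coeff (suc m) * (1# - B (suc m)))
        ≈⟨ solve 3 (λ P c₁ o → P :* (c₁ :* o) := c₁ :* (P :* o)) refl P (coeff (suc m)) (1# - B (suc m)) ⟩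
      coeff (suc m) * (P * (1# - B (suc m))) ∎
      where
      P = prodBelow (λ j → oneMinus x y a n (suc j)) m

    weighted-sum≈rhs : ∀ {m} → m ≤ n → sumTo (λ k → weight k * prodRange B k m) m ≈ rhs x y a m n
    weighted-sum≈rhs {zero}  _     = *-identityʳ _
    weighted-sum≈rhs {suc m} m<n = begin
      sumTo (λ k → weight k * prodRange B k (suc m)) (suc m)        ≈⟨ sumTo-prodRange-suc weight B m ⟩
      sumTo (λ k → weight k * prodRange B k m) m * B m + weight (suc m) ≈⟨ +-congʳ (*-congʳ (weighted-sum≈rhs (<⇒≤ m<n))) ⟩
      rhs x y a m n * B m + weight (suc m)                           ≈⟨ rhs-step m<n ⟩
      rhs x y a (suc m) n                                            ∎

lemma3p13 : ∀ {c ℓ} (R : CommutativeRing c ℓ) (x y a : CommutativeRing.Carrier R)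
            (m n : ℕ) → m ≤ n →
            CommutativeRing._≈_ R (XY.lhs R x y a m n) (XY.rhs R x y a m n)
lemma3p13 R x y a m n m≤n =
  CommutativeRing.trans R (sumTo-cong R m (lhsTerm≈weight*prodRange R x y a n m))
                          (weighted-sum≈rhs R x y a n m≤n)
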